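{- Let $A,B>0$, $q$ a natural number, and $f:\mathbb{Z}\to\mathbb{C}$ a function with $|f(m)|\le A$ and $f(m+q)=f(m)$ for all $m\in\mathbb{Z}$, and $\sum_{m=1}^{q}\left|\sum_{k=1}^{K}f(m+k)\right|^2\le BqK$ for all natural $K$. Fix an integer $n\ge0$, an integer $a$, and a positive integer $N$; let $\tau$ be the integer with $\frac{q_n^{\tau}-1}{2}\le N<\frac{q_n^{\tau+1}-1}{2}$, and for $0\le i\le\tau$ put $K_i=\frac{q_n^{\tau-i}-1}{2}$. Then for every $1\le i\le\tau$, \[ T_{+}(a-K_{i-1},K_{i-1})=2T_{+}(a-q_{n-1}K_i-c_{n-1},\,q_{n-1}K_i+c_{n-1})-T_{ - }(a,q_{n-2}K_i+c_{n-2})+S(a-q_{n}K_i-c_{n},\,(q_{n-2}+q_{n-1})K_i+c_n-c_{n-1}). \]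
   Context: The sequence $(q_n)_{n\ge -2}$ is defined by $q_{ -2}=q_{ -1}=1$, $q_n=2q_{n-1}+q_{n-2}$ for $n\ge0$; and $c_n=\frac{q_n-1}{2}$ for $n\ge-2$ (so $c_{ -2}=c_{ -1}=0$). For integers $x$ and $y\ge 0$: $T_{ - }(x,y)=\sum_{k=1}^{y}(y+1-k)f(x+k)$, $T_{+}(x,y)=\sum_{k=1}^{y}k f(x+k)$, and $S(x,y)=\sum_{i=x+1}^{x+y}\sum_{j=0}^{y-1}f(i+j)$. -}

module Defs where

open import Level using (Level)
open import Data.Nat using (ℕ; zero; suc; _∸_; _^_) renaming (_+_ to _+ℕ_; _*_ to _*ℕ_)
open import Data.Nat.DivMod using (_/_)
open import Data.Integer using (ℤ; +_) renaming (_+_ to _+ℤ_)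
open import Algebra.Bundles using (CommutativeRing)

-- Qs k = q_{k-2}; i.e. q_{-2} = Qs 0, q_{-1} = Qs 1, q_n = Qs (n+2).
Qs : ℕ → ℕ
Qs zero = 1
Qs (suc zero) = 1
Qs (suc (suc k)) = 2 *ℕ Qs (suc k) +ℕ Qs k

-- Cs k = c_{k-2} = (q_{k-2} - 1)/2
Cs : ℕ → ℕ
Cs k = (Qs k ∸ 1) / 2

module Sums {c ℓ : Level} (R : CommutativeRing c ℓ) where
  open CommutativeRing R

  times : ℕ → Carrier → Carrier
  times zero r = 0#
  times (suc n) r = r + times n r

  sum1 : ℕ → (ℕ → Carrier) → Carrier
  sum1 zero g = 0#
  sum1 (suc y) g = sum1 y g + g (suc y)

  sum0 : ℕ → (ℕ → Carrier) → Carrier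
  sum0 zero g = 0#
  sum0 (suc y) g = sum0 y g + g y

  T₋ : (ℤ → Carrier) → ℤ → ℕ → Carrier
  T₋ f x y = sum1 y (λ k → times (y +ℕ 1 ∸ k) (f (x +ℤ + k)))

  T₊ : (ℤ → Carrier) → ℤ → ℕ → Carrier
  T₊ f x y = sum1 y (λ k → times k (f (x +ℤ + k)))

  S : (ℤ → Carrier) → ℤ → ℕ → Carrier
  S f x y = sum1 y (λ i → sum0 y (λ j → f ((x +ℤ + i) +ℤ + j)))

  Car : Set c
  Car = Carrier

  infixl 6 _⊕_ _⊖_
  infix 4 _≋_
  _⊕_ : Carrier → Carrier → Carrier
  x ⊕ y = x + y

  _⊖_ : Carrier → Carrier → Carrier
  x ⊖ y = x - y

  _≋_ : Carrier → Carrier → Set ℓ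
  x ≋ y = x ≈ y

module Submission where

-- The identity is a purely combinatorial fact about weighted window sums.  Writing
--   P = q_{n-1} K_i + c_{n-1},   R = q_{n-2} K_i + c_{n-2},
--   W = P + R + 1,               L = W + P,
-- the arithmetic of the q_n and c_n (q_n = 2 q_{n-1} + q_{n-2}, all q_n odd,
-- c_n = 2 c_{n-1} + c_{n-2} + 1, K_{i-1} = q_n K_i + c_n) shows that the
-- theorem reads  T₊(a-L, L) = 2 T₊(a-P, P) - T₋(a, R) + S(a-L, W).
--
-- Reading f from position a-L, i.e. h(t) = f(a-L+t), all four sums become
-- sums over ℕ with piecewise linear weights: an ascending ramp Σ t h(t), a
-- descending ramp Σ (n+1-t) h(t) and the square Σ_i Σ_j h(i+j).  The key
-- fact ("tent") is that the square of side m+1 is the ascending ramp of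
-- length m+1 followed by the descending ramp of length m; it is proved by
-- induction on m, peeling off the first row and last column of the square.
-- Comparing weights on the three blocks [1,W], [W+1,L], [L+1,L+R] then
-- gives  T₊(a-L, L) + T₋(a, R) = 2 T₊(a-P, P) + S(a-L, W).

open import Defs
open import Level using (Level)
open import Data.Nat using (ℕ; zero; suc; _+_; _*_; _∸_; _^_; _≤_; _<_)
import Data.Nat.Properties as ℕₚ
open import Data.Nat.DivMod using (_/_; m*n/n≡m)
open import Data.Nat.Tactic.RingSolver using (solve-∀)
open import Data.Integer using (ℤ; +_) renaming (_+_ to _+ℤ_; _-_ to _-ℤ_)
import Data.Integer.Properties as ℤₚ
open import Data.Integer.Tactic.RingSolver using () renaming (solve-∀ to ℤ-solve-∀)
open import Algebra.Bundles using (CommutativeRing)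
import Relation.Binary.PropositionalEquality as ≡
open ≡ using (_≡_)

module Windows {c ℓ : Level} (CR : CommutativeRing c ℓ) where
  open CommutativeRing CR hiding (_+_; _*_)
  open Sums CR
  open import Relation.Binary.Reasoning.Setoid setoid
  open import Algebra.Properties.AbelianGroup +-abelianGroup using (xyx⁻¹≈y)
  open import Algebra.Solver.Ring.NaturalCoefficients.Default commutativeSemiring
    using (solve; _:=_; _:+_; con)

  times-+ : ∀ m n x → times (m + n) x ≈ times m x ⊕ times n x
  times-+ zero n x = sym (+-identityˡ _)
  times-+ (suc m) n x = trans (+-congˡ (times-+ m n x)) (sym (+-assoc _ _ _))

  sum1-cong : ∀ n {h h' : ℕ → Carrier} →
    (∀ k → k < n → h (suc k) ≈ h' (suc k)) → sum1 n h ≈ sum1 n h'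
  sum1-cong zero eq = refl
  sum1-cong (suc n) eq =
    +-cong (sum1-cong n (λ k k<n → eq k (ℕₚ.m<n⇒m<1+n k<n))) (eq n ℕₚ.≤-refl)

  sum0-cong : ∀ n {h h' : ℕ → Carrier} → (∀ j → h j ≈ h' j) → sum0 n h ≈ sum0 n h'
  sum0-cong zero eq = refl
  sum0-cong (suc n) eq = +-cong (sum0-cong n eq) (eq n)

  sum0-suc : ∀ n (h : ℕ → Carrier) → sum0 n (λ j → h (suc j)) ≡ sum1 n h
  sum0-suc zero h = ≡.refl
  sum0-suc (suc n) h = ≡.cong (_⊕ h (suc n)) (sum0-suc n h)

  sum1-+ : ∀ n (h h' : ℕ → Carrier) →
    sum1 n (λ k → h k ⊕ h' k) ≈ sum1 n h ⊕ sum1 n h'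
  sum1-+ zero h h' = sym (+-identityˡ _)
  sum1-+ (suc n) h h' = begin
    sum1 n (λ k → h k ⊕ h' k) ⊕ (h (suc n) ⊕ h' (suc n))
      ≈⟨ +-congʳ (sum1-+ n h h') ⟩
    (sum1 n h ⊕ sum1 n h') ⊕ (h (suc n) ⊕ h' (suc n))
      ≈⟨ solve 4 (λ a b x y → (a :+ b) :+ (x :+ y) := (a :+ x) :+ (b :+ y)) refl _ _ _ _ ⟩
    (sum1 n h ⊕ h (suc n)) ⊕ (sum1 n h' ⊕ h' (suc n)) ∎

  sum1-split : ∀ m n (h : ℕ → Carrier) →
    sum1 (m + n) h ≈ sum1 m h ⊕ sum1 n (λ k → h (m + k))
  sum1-split m zero h = begin
    sum1 (m + 0) h ≡⟨ ≡.cong (λ z → sum1 z h) (ℕₚ.+-identityʳ m) ⟩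
    sum1 m h       ≈⟨ sym (+-identityʳ _) ⟩
    sum1 m h ⊕ 0#  ∎
  sum1-split m (suc n) h = begin
    sum1 (m + suc n) h
      ≡⟨ ≡.cong (λ z → sum1 z h) (ℕₚ.+-suc m n) ⟩
    sum1 (m + n) h ⊕ h (suc (m + n))
      ≈⟨ +-cong (sum1-split m n h) (reflexive (≡.cong h (≡.sym (ℕₚ.+-suc m n)))) ⟩
    (sum1 m h ⊕ sum1 n (λ k → h (m + k))) ⊕ h (m + suc n)
      ≈⟨ +-assoc _ _ _ ⟩
    sum1 m h ⊕ sum1 (suc n) (λ k → h (m + k)) ∎

  sum1-peel : ∀ n (h : ℕ → Carrier) → sum1 (suc n) h ≈ h 1 ⊕ sum1 n (λ k → h (suc k))
  sum1-peel zero h = trans (+-identityˡ _) (sym (+-identityʳ _))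
  sum1-peel (suc n) h = trans (+-congʳ (sum1-peel n h)) (+-assoc _ _ _)

  shift : ℕ → (ℕ → Carrier) → ℕ → Carrier
  shift o h t = h (o + t)

  ramp : (ℕ → Carrier) → ℕ → Carrier
  ramp h n = sum1 n (λ k → times k (h k))

  ramp⁻ : (ℕ → Carrier) → ℕ → Carrier
  ramp⁻ h n = sum1 n (λ k → times (n + 1 ∸ k) (h k))

  square : (ℕ → Carrier) → ℕ → Carrier
  square h n = sum1 n (λ i → sum0 n (λ j → h (i + j)))

  ramp-step : ∀ n h → ramp h (suc n) ≈ ramp (shift 1 h) n ⊕ sum1 (suc n) h
  ramp-step zero h =
    solve 1 (λ x → (con 0) :+ (x :+ (con 0)) := (con 0) :+ ((con 0) :+ x)) refl (h 1)
  ramp-step (suc n) h = begin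
    ramp h (suc n) ⊕ (x ⊕ times (suc n) x)
      ≈⟨ +-congʳ (ramp-step n h) ⟩
    (ramp (shift 1 h) n ⊕ sum1 (suc n) h) ⊕ (x ⊕ times (suc n) x)
      ≈⟨ solve 4 (λ a b y z → (a :+ b) :+ (y :+ z) := (a :+ z) :+ (b :+ y)) refl _ _ _ _ ⟩
    ramp (shift 1 h) (suc n) ⊕ sum1 (suc (suc n)) h ∎
    where x = h (suc (suc n))

  ramp⁻-step : ∀ n h → ramp⁻ h (suc n) ≈ ramp⁻ h n ⊕ sum1 (suc n) h
  ramp⁻-step n h = begin
    sum1 n (λ k → times (suc n + 1 ∸ k) (h k)) ⊕ times (suc n + 1 ∸ suc n) (h (suc n))
      ≈⟨ +-cong (sum1-cong n weight) (reflexive (≡.cong (λ w → times w (h (suc n))) (ℕₚ.m+n∸m≡n n 1))) ⟩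
    sum1 n (λ k → h k ⊕ times (n + 1 ∸ k) (h k)) ⊕ (h (suc n) ⊕ 0#)
      ≈⟨ +-cong (sum1-+ n h _) (+-identityʳ _) ⟩
    (sum1 n h ⊕ ramp⁻ h n) ⊕ h (suc n)
      ≈⟨ solve 3 (λ a b x → (a :+ b) :+ x := b :+ (a :+ x)) refl _ _ _ ⟩
    ramp⁻ h n ⊕ sum1 (suc n) h ∎
    where
    weight : ∀ k → k < n → times (suc n + 1 ∸ suc k) (h (suc k)) ≈ h (suc k) ⊕ times (n + 1 ∸ suc k) (h (suc k))
    weight k k<n = reflexive (≡.cong (λ w → times w (h (suc k))) (ℕₚ.+-∸-assoc 1 (ℕₚ.m≤n⇒m≤n+o 1 k<n)))

  square-step : ∀ n h →
    square h (suc n) ≈ sum1 (suc n) h ⊕ (square (shift 1 h) n ⊕ sum1 n (shift (suc n) h))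
  square-step n h = begin
    square h (suc n)
      ≈⟨ sum1-peel n _ ⟩
    sum0 (suc n) (λ j → h (suc j)) ⊕ sum1 n (λ i → sum0 n (λ j → h (suc i + j)) ⊕ h (suc i + n))
      ≈⟨ +-cong (reflexive (sum0-suc (suc n) h)) (sum1-+ n _ _) ⟩
    sum1 (suc n) h ⊕ (square (shift 1 h) n ⊕ sum1 n (λ i → h (suc i + n)))
      ≈⟨ +-congˡ (+-congˡ (sum1-cong n (λ i _ → reflexive (≡.cong h (≡.cong suc (ℕₚ.+-comm (suc i) n)))))) ⟩
    sum1 (suc n) h ⊕ (square (shift 1 h) n ⊕ sum1 n (shift (suc n) h)) ∎

  -- Tent: the square of side m+1 carries weights 1,2,…,m+1,m,…,1, i.e. it
  -- is an ascending ramp of length m+1 followed by a descending ramp of length m.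
  tent : ∀ m h → square h (suc m) ≈ ramp h (suc m) ⊕ ramp⁻ (shift (suc m) h) m
  tent zero h =
    solve 1 (λ x → (con 0) :+ ((con 0) :+ x) := ((con 0) :+ (x :+ (con 0))) :+ (con 0)) refl (h 1)
  tent (suc m) h = begin
    square h (suc (suc m))
      ≈⟨ square-step (suc m) h ⟩
    sum1 (suc (suc m)) h ⊕ (square (shift 1 h) (suc m) ⊕ sum1 (suc m) (shift (suc (suc m)) h))
      ≈⟨ +-congˡ (+-congʳ (tent m (shift 1 h))) ⟩
    sum1 (suc (suc m)) h ⊕ ((ramp (shift 1 h) (suc m) ⊕ ramp⁻ (shift (suc (suc m)) h) m)
                             ⊕ sum1 (suc m) (shift (suc (suc m)) h))
      ≈⟨ solve 4 (λ a b x y → a :+ ((b :+ x) :+ y) := (b :+ a) :+ (x :+ y)) refl _ _ _ _ ⟩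
    (ramp (shift 1 h) (suc m) ⊕ sum1 (suc (suc m)) h)
      ⊕ (ramp⁻ (shift (suc (suc m)) h) m ⊕ sum1 (suc m) (shift (suc (suc m)) h))
      ≈⟨ sym (+-cong (ramp-step (suc m) h) (ramp⁻-step m _)) ⟩
    ramp h (suc (suc m)) ⊕ ramp⁻ (shift (suc (suc m)) h) (suc m) ∎

  ramp⁻-split : ∀ o m n h →
    ramp⁻ (shift o h) (m + n)
      ≈ sum1 m (λ j → times (m + n + 1 ∸ j) (h (o + j))) ⊕ ramp⁻ (shift (o + m) h) n
  ramp⁻-split o m n h =
    trans (sum1-split m n _) (+-congˡ (sum1-cong n (λ k _ → reflexive (≡.cong₂ times weight point))))
    where
    weight : ∀ {k} → m + n + 1 ∸ (m + suc k) ≡ n + 1 ∸ suc k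
    weight {k} = ≡.trans (≡.cong (_∸ (m + suc k)) (ℕₚ.+-assoc m n 1)) (ℕₚ.[m+n]∸[m+o]≡n∸o m (n + 1) (suc k))
    point : ∀ {k} → h (o + (m + suc k)) ≡ h (o + m + suc k)
    point {k} = ≡.cong h (≡.sym (ℕₚ.+-assoc o m (suc k)))

  ramp-excess : ∀ V P h → P ≤ V + 1 →
    sum1 P (λ j → times (suc V + j) (h j))
      ≈ ramp h P ⊕ (ramp h P ⊕ sum1 P (λ j → times (V + 1 ∸ j) (h j)))
  ramp-excess V P h P≤ = begin
    sum1 P (λ j → times (suc V + j) (h j))
      ≈⟨ sum1-cong P (λ k k<P → split-weight (suc k) (ℕₚ.≤-trans k<P P≤)) ⟩
    sum1 P (λ j → times j (h j) ⊕ (times j (h j) ⊕ times (V + 1 ∸ j) (h j)))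
      ≈⟨ trans (sum1-+ P _ _) (+-congˡ (sum1-+ P _ _)) ⟩
    ramp h P ⊕ (ramp h P ⊕ sum1 P (λ j → times (V + 1 ∸ j) (h j))) ∎
    where
    index : ∀ j → j ≤ V + 1 → suc V + j ≡ j + (j + (V + 1 ∸ j))
    index j j≤ = ≡.sym (≡.trans (≡.cong (λ z → j + z) (ℕₚ.m+[n∸m]≡n j≤))
                   (≡.trans (ℕₚ.+-comm j (V + 1)) (≡.cong (_+ j) (ℕₚ.+-comm V 1))))
    split-weight : ∀ j → j ≤ V + 1 →
      times (suc V + j) (h j) ≈ times j (h j) ⊕ (times j (h j) ⊕ times (V + 1 ∸ j) (h j))
    split-weight j j≤ = begin
      times (suc V + j) (h j)                ≡⟨ ≡.cong (λ w → times w (h j)) (index j j≤) ⟩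
      times (j + (j + (V + 1 ∸ j))) (h j)    ≈⟨ trans (times-+ j _ _) (+-congˡ (times-+ j _ _)) ⟩
      times j (h j) ⊕ (times j (h j) ⊕ times (V + 1 ∸ j) (h j)) ∎

  window-identity : ∀ P R h → let W = suc (P + R) in
    ramp h (W + P) ⊕ ramp⁻ (shift (W + P) h) R ≈ times 2 (ramp (shift W h) P) ⊕ square h W
  window-identity P R h = begin
    ramp h (W + P) ⊕ ramp⁻ (shift (W + P) h) R
      ≈⟨ +-congʳ (sum1-split W P _) ⟩
    (ramp h W ⊕ sum1 P (λ j → times (W + j) (h (W + j)))) ⊕ E
      ≈⟨ +-congʳ (+-congˡ (ramp-excess (P + R) P (shift W h) (ℕₚ.m≤n⇒m≤n+o 1 (ℕₚ.m≤m+n P R)))) ⟩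
    (ramp h W ⊕ (U ⊕ (U ⊕ D))) ⊕ E
      ≈⟨ solve 4 (λ t u d e → (t :+ (u :+ (u :+ d))) :+ e := (u :+ (u :+ (con 0))) :+ (t :+ (d :+ e)))
           refl (ramp h W) U D E ⟩
    times 2 U ⊕ (ramp h W ⊕ (D ⊕ E))
      ≈⟨ +-congˡ (+-congˡ (sym (ramp⁻-split W P R h))) ⟩
    times 2 U ⊕ (ramp h W ⊕ ramp⁻ (shift W h) (P + R))
      ≈⟨ +-congˡ (sym (tent (P + R) h)) ⟩
    times 2 U ⊕ square h W ∎
    where
    W = suc (P + R)
    U = ramp (shift W h) P
    D = sum1 P (λ j → times (P + R + 1 ∸ j) (h (W + j)))
    E = ramp⁻ (shift (W + P) h) R

  from : ℤ → (ℤ → Carrier) → ℕ → Carrier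
  from x f t = f (x +ℤ + t)

  from-shift : ∀ x f o t → from x f (o + t) ≡ from (x +ℤ + o) f t
  from-shift x f o t =
    ≡.cong f (≡.trans (≡.cong (x +ℤ_) (ℤₚ.pos-+ o t)) (≡.sym (ℤₚ.+-assoc x (+ o) (+ t))))

  T₊-shift : ∀ f x o n → ramp (shift o (from x f)) n ≈ T₊ f (x +ℤ + o) n
  T₊-shift f x o n = sum1-cong n (λ k _ → reflexive (≡.cong (times (suc k)) (from-shift x f o (suc k))))

  T₋-shift : ∀ f x o n → ramp⁻ (shift o (from x f)) n ≈ T₋ f (x +ℤ + o) n
  T₋-shift f x o n = sum1-cong n (λ k _ → reflexive (≡.cong (times (n + 1 ∸ suc k)) (from-shift x f o (suc k))))

  S-square : ∀ f x n → square (from x f) n ≈ S f x n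
  S-square f x n = sum1-cong n (λ i _ → sum0-cong n (λ j → reflexive (from-shift x f (suc i) j)))

  window-identityℤ : ∀ f a P R → let W = suc (P + R) ; L = W + P in
    T₊ f (a -ℤ + L) L ⊕ T₋ f a R ≈ times 2 (T₊ f (a -ℤ + P) P) ⊕ S f (a -ℤ + L) W
  window-identityℤ f a P R = begin
    ramp h L ⊕ T₋ f a R
      ≈⟨ +-congˡ (trans (reflexive (≡.cong (λ y → T₋ f y R) (≡.sym (end-point a (+ L)))))
                        (sym (T₋-shift f (a -ℤ + L) L R))) ⟩
    ramp h L ⊕ ramp⁻ (shift L h) R
      ≈⟨ window-identity P R h ⟩
    times 2 (ramp (shift W h) P) ⊕ square h W
      ≈⟨ +-cong (double (trans (T₊-shift f (a -ℤ + L) W P)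
                               (reflexive (≡.cong (λ y → T₊ f y P) start-point))))
                (S-square f (a -ℤ + L) W) ⟩
    times 2 (T₊ f (a -ℤ + P) P) ⊕ S f (a -ℤ + L) W ∎
    where
    W = suc (P + R)
    L = W + P
    h = from (a -ℤ + L) f
    end-point : ∀ b l → (b -ℤ l) +ℤ l ≡ b
    end-point = ℤ-solve-∀
    start-point : (a -ℤ + L) +ℤ + W ≡ a -ℤ + P
    start-point = ≡.trans (≡.cong (λ l → (a -ℤ l) +ℤ + W) (ℤₚ.pos-+ W P)) (shifted a (+ W) (+ P))
      where
      shifted : ∀ b w p → (b -ℤ (w +ℤ p)) +ℤ w ≡ b -ℤ p
      shifted = ℤ-solve-∀
    double : ∀ {x y} → x ≈ y → times 2 x ≈ times 2 y
    double x≈y = +-cong x≈y (+-congʳ x≈y)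

  solve-for : ∀ x v u s → x ⊕ v ≈ u ⊕ s → x ≈ (u ⊖ v) ⊕ s
  solve-for x v u s eq = begin
    x                ≈⟨ sym (xyx⁻¹≈y v x) ⟩
    (v ⊕ x) ⊕ (- v)  ≈⟨ +-congʳ (trans (+-comm v x) eq) ⟩
    (u ⊕ s) ⊕ (- v)  ≈⟨ solve 3 (λ a b y → (a :+ b) :+ y := (a :+ y) :+ b) refl u s (- v) ⟩
    (u ⊖ v) ⊕ s      ∎

  -- The window identity in the shape of the theorem, with the three lengths
  -- W, L and L' given only up to equality.
  window-identity-solved : ∀ f a P R {W L L'} →
    W ≡ suc (P + R) → L ≡ suc (P + R) + P → L' ≡ suc (P + R) + P →
    T₊ f (a -ℤ + L) L ≋ (times 2 (T₊ f (a -ℤ + P) P) ⊖ T₋ f a R) ⊕ S f (a -ℤ + L') W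
  window-identity-solved f a P R ≡.refl ≡.refl ≡.refl = solve-for _ _ _ _ (window-identityℤ f a P R)

-- Arithmetic of q_n and c_n.  With  half x = (x-1)/2  we have c_n = half q_n
-- and K_i = half (q_n^{τ-i}); everything rests on all these numbers being odd.

half : ℕ → ℕ
half x = (x ∸ 1) / 2

Odd : ℕ → Set
Odd x = x ≡ suc (half x * 2)

half-odd : ∀ e → half (suc (e * 2)) ≡ e
half-odd e = m*n/n≡m e 2

odd-intro : ∀ {x} e → x ≡ suc (e * 2) → Odd x
odd-intro e ≡.refl = ≡.cong (λ z → suc (z * 2)) (≡.sym (half-odd e))

odd-product : ∀ {x y} → Odd x → Odd y → x * y ≡ suc ((x * half y + half x) * 2)
odd-product {x} {y} ox oy = begin
  x * y                                       ≡⟨ ≡.cong₂ _*_ ox oy ⟩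
  suc (half x * 2) * suc (half y * 2)         ≡⟨ expand (half x) (half y) ⟩
  suc ((suc (half x * 2) * half y + half x) * 2) ≡⟨ ≡.cong (λ z → suc ((z * half y + half x) * 2)) ox ⟨
  suc ((x * half y + half x) * 2)             ∎
  where
  open ≡.≡-Reasoning
  expand : ∀ c e → suc (c * 2) * suc (e * 2) ≡ suc ((suc (c * 2) * e + c) * 2)
  expand = solve-∀

-- half of a product of odd numbers: this is K_{i-1} = q_n K_i + c_n.
half-* : ∀ {x y} → Odd x → Odd y → half (x * y) ≡ x * half y + half x
half-* ox oy = ≡.trans (≡.cong half (odd-product ox oy)) (half-odd _)

odd-^ : ∀ {x} → Odd x → ∀ m → Odd (x ^ m)
odd-^ ox zero = ≡.refl
odd-^ {x} ox (suc m) = odd-intro (x * half (x ^ m) + half x) (odd-product ox (odd-^ ox m))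

odd-combination : ∀ {p r} → Odd p → Odd r → 2 * p + r ≡ suc (suc (half p * 2 + half r) * 2)
odd-combination {p} {r} op or =
  ≡.trans (≡.cong₂ (λ x y → 2 * x + y) op or) (expand (half p) (half r))
  where
  expand : ∀ c e → 2 * suc (c * 2) + suc (e * 2) ≡ suc (suc (c * 2 + e) * 2)
  expand = solve-∀

Qs-odd : ∀ k → Odd (Qs k)
Qs-odd zero = ≡.refl
Qs-odd (suc zero) = ≡.refl
Qs-odd (suc (suc k)) =
  odd-intro (suc (Cs (suc k) * 2 + Cs k)) (odd-combination (Qs-odd (suc k)) (Qs-odd k))

Qs-rec : ∀ n → Qs (n + 2) ≡ 2 * Qs (n + 1) + Qs n
Qs-rec n rewrite ℕₚ.+-comm n 2 | ℕₚ.+-comm n 1 = ≡.refl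

Cs-rec : ∀ n → Cs (n + 2) ≡ suc (Cs (n + 1) * 2 + Cs n)
Cs-rec n = ≡.trans (≡.cong half (≡.trans (Qs-rec n) (odd-combination (Qs-odd (n + 1)) (Qs-odd n))))
                   (half-odd _)

-- With P = p k + c₁ and R = r k + c₀ (p, r, c₁, c₀ in the roles of
-- q_{n-1}, q_{n-2}, c_{n-1}, c_{n-2}), the length of the S-window is P + R + 1 …
window-width : ∀ p r k c₀ c₁ c₂ → c₂ ≡ suc (c₁ * 2 + c₀) →
  (r + p) * k + c₂ ∸ c₁ ≡ suc ((p * k + c₁) + (r * k + c₀))
window-width p r k c₀ c₁ c₂ ≡.refl =
  ≡.trans (≡.cong (_∸ c₁) (regroup p r k c₀ c₁)) (ℕₚ.m+n∸n≡m _ c₁)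
  where
  regroup : ∀ p r k c₀ c₁ →
    (r + p) * k + suc (c₁ * 2 + c₀) ≡ suc ((p * k + c₁) + (r * k + c₀)) + c₁
  regroup = solve-∀

window-length : ∀ Q p r k c₀ c₁ c₂ → Q ≡ 2 * p + r → c₂ ≡ suc (c₁ * 2 + c₀) →
  Q * k + c₂ ≡ suc ((p * k + c₁) + (r * k + c₀)) + (p * k + c₁)
window-length Q p r k c₀ c₁ c₂ ≡.refl ≡.refl = regroup p r k c₀ c₁
  where
  regroup : ∀ p r k c₀ c₁ →
    (2 * p + r) * k + suc (c₁ * 2 + c₀) ≡ suc ((p * k + c₁) + (r * k + c₀)) + (p * k + c₁)
  regroup = solve-∀

lemma2 : ∀ {c ℓ : Level} (R : CommutativeRing c ℓ) →
    let open Sums R in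
    (q : ℕ) (f : ℤ → Car) →
    (∀ m → f (m +ℤ + q) ≡ f m) →
    (n : ℕ) (a : ℤ) (N : ℕ) → 1 ≤ N →
    (τ : ℕ) → (Qs (n + 2) ^ τ ∸ 1) / 2 ≤ N → N < (Qs (n + 2) ^ suc τ ∸ 1) / 2 →
    let K = λ (i : ℕ) → (Qs (n + 2) ^ (τ ∸ i) ∸ 1) / 2 in
    (i : ℕ) → 1 ≤ i → i ≤ τ →
    T₊ f (a -ℤ + K (i ∸ 1)) (K (i ∸ 1))
      ≋ (times 2 (T₊ f (a -ℤ + (Qs (n + 1) * K i + Cs (n + 1))) (Qs (n + 1) * K i + Cs (n + 1)))
          ⊖ T₋ f a (Qs n * K i + Cs n))
        ⊕ S f (a -ℤ + (Qs (n + 2) * K i + Cs (n + 2)))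
              ((Qs n + Qs (n + 1)) * K i + Cs (n + 2) ∸ Cs (n + 1))
lemma2 R _ f _ n a _ _ τ _ _ zero () _
lemma2 R _ f _ n a _ _ τ _ _ (suc j) _ j<τ =
  Windows.window-identity-solved R f a (p * k + c₁) (r * k + c₀)
    (window-width p r k c₀ c₁ c₂ (Cs-rec n))
    (≡.trans K-prev qk+c≡L)
    qk+c≡L
  where
  Q = Qs (n + 2)
  p = Qs (n + 1)
  r = Qs n
  c₀ = Cs n
  c₁ = Cs (n + 1)
  c₂ = Cs (n + 2)
  k = half (Q ^ (τ ∸ suc j))
  qk+c≡L : Q * k + c₂ ≡ suc ((p * k + c₁) + (r * k + c₀)) + (p * k + c₁)
  qk+c≡L = window-length Q p r k c₀ c₁ c₂ (Qs-rec n) (Cs-rec n)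
  -- K_{i-1} = q_n K_i + c_n, since τ - (i-1) = (τ - i) + 1.
  K-prev : half (Q ^ (τ ∸ j)) ≡ Q * k + c₂
  K-prev = ≡.trans (≡.cong (λ m → half (Q ^ m)) (ℕₚ.+-∸-assoc 1 j<τ))
                   (half-* (Qs-odd (n + 2)) (odd-^ (Qs-odd (n + 2)) (τ ∸ suc j)))
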